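{- Let $G$ be a cubic graph on $n$ vertices with $\tau(G)=4$. Then $b(G)\le \frac{n}{12}$.
   Context: For a bridgeless cubic graph $G$, $\tau(G)$ is the minimum number of perfect matchings of $G$ whose union is $E(G)$. A set $A\subseteq E(G)$ is a balanced matching if there exist two perfect matchings $M_1,M_2$ of $G$ with $A=M_1\cap M_2$; $b(G)$ denotes the minimum size of a balanced matching of $G$. -}

module Defs where

open import Data.Nat using (ℕ; _<_)
open import Data.Fin using (Fin; _≟_)
open import Data.Fin.Subset using (Subset; _∈_; _∩_; ∣_∣)
open import Data.Vec using (Vec; tabulate; lookup)
open import Data.Bool using (Bool; _∨_)
open import Data.Product using (_×_; Σ; ∃; ∃-syntax; _,_; proj₁; proj₂)
open import Relation.Nullary using (¬_)
open import Relation.Nullary.Decidable using (⌊_⌋)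
open import Relation.Binary.PropositionalEquality using (_≡_; _≢_)

-- A finite loopless multigraph: vertices Fin n, edges Fin m, each edge
-- has two distinct end-vertices (parallel edges allowed).
record Graph (n : ℕ) : Set where
  field
    m       : ℕ
    ends    : Fin m → Fin n × Fin n
    loopless : ∀ e → proj₁ (ends e) ≢ proj₂ (ends e)
open Graph public

module _ {n : ℕ} (G : Graph n) where

  incidentB : Fin n → Fin (m G) → Bool
  incidentB v e = ⌊ v ≟ proj₁ (ends G e) ⌋ ∨ ⌊ v ≟ proj₂ (ends G e) ⌋

  incident : Fin n → Subset (m G)
  incident v = tabulate (incidentB v)

  Cubic : Set
  Cubic = ∀ v → ∣ incident v ∣ ≡ 3

  data ConnAvoiding (e : Fin (m G)) : Fin n → Fin n → Set where
    here  : ∀ {u} → ConnAvoiding e u u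
    stepF : ∀ {u w} (f : Fin (m G)) → f ≢ e →
            ConnAvoiding e u (proj₁ (ends G f)) → w ≡ proj₂ (ends G f) →
            ConnAvoiding e u w
    stepB : ∀ {u w} (f : Fin (m G)) → f ≢ e →
            ConnAvoiding e u (proj₂ (ends G f)) → w ≡ proj₁ (ends G f) →
            ConnAvoiding e u w

  Bridgeless : Set
  Bridgeless = ∀ e → ConnAvoiding e (proj₁ (ends G e)) (proj₂ (ends G e))

  PerfectMatching : Subset (m G) → Set
  PerfectMatching M = ∀ v → ∣ M ∩ incident v ∣ ≡ 1

  PMCover : ℕ → Set
  PMCover k = Σ (Vec (Subset (m G)) k) λ Ms →
                (∀ i → PerfectMatching (lookup Ms i)) ×
                (∀ e → ∃[ i ] (e ∈ lookup Ms i))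

  IsTau : ℕ → Set
  IsTau k = PMCover k × (∀ j → j < k → ¬ PMCover j)

  Balanced : Subset (m G) → Set
  Balanced A = ∃[ M₁ ] ∃[ M₂ ] (PerfectMatching M₁ × PerfectMatching M₂ × A ≡ M₁ ∩ M₂)

  IsB : ℕ → Set
  IsB k = (∃[ A ] (Balanced A × ∣ A ∣ ≡ k)) × (∀ A → Balanced A → k Data.Nat.≤ ∣ A ∣)

-- Fix perfect matchings M₀,…,M₃ covering E(G), and for an edge e let mult(e)
-- be the number of Mᵢ containing e.  The proof is a double count of the
-- quantity  Ω = Σᵢ Σ_{j≠i} |Mᵢ ∩ Mⱼ| = Σₑ mult(e)·(mult(e) − 1).
--   * Lower bound: every Mᵢ ∩ Mⱼ is a balanced matching, so Ω ≥ 4·3·b(G).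
--   * Upper bound: each Mᵢ meets the three edges at a vertex v exactly once,
--     so these edges have multiplicities summing to 4, each at least 1; the
--     excesses mult(e) − 1 at v sum to 1, hence Σ_{e∋v} mult(e)(mult(e) − 1) ≤ 2.
--     Summing over v counts every edge twice, so 2Ω ≤ 2n.
module Submission where

open import Defs
open import Data.Nat using (ℕ; _*_; _≤_; zero; suc; _+_; _∸_; z≤n; s≤s)
open import Data.Nat.Properties
  using (+-*-semiring; +-identityʳ; *-identityʳ; *-identityˡ; *-zeroʳ; *-comm;
         *-distribʳ-+; +-cancelʳ-≡; m+n∸n≡m; m+[n∸m]≡n; +-mono-≤; *-monoˡ-≤;
         *-monoʳ-≤; *-cancelˡ-≤; m≤m+n; m≤n+m; ≤-trans; module ≤-Reasoning)
open import Data.Nat.Tactic.RingSolver using (solve-∀)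
open import Data.Bool using (Bool; true; false; not; _∧_)
open import Data.Fin using (Fin; _≟_) renaming (zero to fz; suc to fs)
open import Data.Fin.Subset using (Subset; _∈_; _∩_; ∣_∣)
open import Data.Vec using (Vec; []; _∷_; lookup)
open import Data.Vec.Properties using (lookup-zipWith; lookup∘tabulate; []=⇒lookup)
open import Data.Product using (∃; _,_; proj₁; proj₂)
open import Function using (_∘_)
open import Relation.Nullary using (yes; no; does)
open import Relation.Binary.PropositionalEquality
  using (_≡_; refl; sym; trans; cong; cong₂; subst; module ≡-Reasoning)
open import Data.Empty using (⊥-elim)
open import Algebra.Properties.Semiring.Sum +-*-semiring
  using (sum-syntax; sum-cong-≗; sum-replicate-zero; ∑-distrib-+; ∑-comm;
         *-distribˡ-sum; *-distribʳ-sum)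

𝟙 : Bool → ℕ
𝟙 true  = 1
𝟙 false = 0

𝟙-∧ : ∀ x y → 𝟙 (x ∧ y) ≡ 𝟙 x * 𝟙 y
𝟙-∧ true  y = sym (+-identityʳ (𝟙 y))
𝟙-∧ false y = refl

𝟙-idem : ∀ x → 𝟙 x * 𝟙 x ≡ 𝟙 x
𝟙-idem true  = refl
𝟙-idem false = refl

𝟙-not : ∀ x → 𝟙 (not x) + 𝟙 x ≡ 1
𝟙-not true  = refl
𝟙-not false = refl

∑-mono-≤ : ∀ {k} {f g : Fin k → ℕ} → (∀ i → f i ≤ g i) →
           ∑[ i < k ] f i ≤ ∑[ i < k ] g i
∑-mono-≤ {zero}  _ = z≤n
∑-mono-≤ {suc k} h = +-mono-≤ (h fz) (∑-mono-≤ (h ∘ fs))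

∑-term-≤ : ∀ {k} (f : Fin k → ℕ) i → f i ≤ ∑[ j < k ] f j
∑-term-≤ f fz     = m≤m+n (f fz) _
∑-term-≤ f (fs i) = ≤-trans (∑-term-≤ (f ∘ fs) i) (m≤n+m _ (f fz))

∑-const : ∀ k c → ∑[ i < k ] c ≡ k * c
∑-const zero    c = refl
∑-const (suc k) c = cong (c +_) (∑-const k c)

δ : ∀ {k} → Fin k → Fin k → ℕ
δ i j = 𝟙 (does (i ≟ j))

δ̄ : ∀ {k} → Fin k → Fin k → ℕ
δ̄ i j = 𝟙 (not (does (i ≟ j)))

δ̄+δ : ∀ {k} (i j : Fin k) → δ̄ i j + δ i j ≡ 1
δ̄+δ i j = 𝟙-not (does (i ≟ j))

∑-pick : ∀ {k} (f : Fin k → ℕ) i → ∑[ j < k ] (δ i j * f j) ≡ f i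
∑-pick {suc k} f fz =
  trans (cong₂ _+_ (+-identityʳ (f fz)) (sum-replicate-zero k)) (+-identityʳ (f fz))
∑-pick {suc k} f (fs i) = ∑-pick {k} (f ∘ fs) i

δ-sym : ∀ {k} (i j : Fin k) → δ i j ≡ δ j i
δ-sym i j with i ≟ j | j ≟ i
... | yes _ | yes _ = refl
... | no _  | no _  = refl
... | yes p | no ¬q = ⊥-elim (¬q (sym p))
... | no ¬p | yes q = ⊥-elim (¬p (sym q))

∑-δ : ∀ {k} (i : Fin k) → ∑[ j < k ] δ j i ≡ 1
∑-δ {k} i = trans (sum-cong-≗ λ j → trans (δ-sym j i) (sym (*-identityʳ (δ i j))))
                  (∑-pick (λ _ → 1) i)

∑-without : ∀ {k} (f : Fin k → ℕ) i → ∑[ j < k ] (δ̄ i j * f j) + f i ≡ ∑[ j < k ] f j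
∑-without {k} f i = begin
  ∑[ j < k ] (δ̄ i j * f j) + f i
    ≡⟨ cong (∑[ j < k ] (δ̄ i j * f j) +_) (sym (∑-pick f i)) ⟩
  ∑[ j < k ] (δ̄ i j * f j) + ∑[ j < k ] (δ i j * f j)
    ≡⟨ sym (∑-distrib-+ (λ j → δ̄ i j * f j) (λ j → δ i j * f j)) ⟩
  ∑[ j < k ] (δ̄ i j * f j + δ i j * f j)
    ≡⟨ sum-cong-≗ (λ j → sym (*-distribʳ-+ (f j) (δ̄ i j) (δ i j))) ⟩
  ∑[ j < k ] ((δ̄ i j + δ i j) * f j)
    ≡⟨ sum-cong-≗ (λ j → trans (cong (_* f j) (δ̄+δ i j)) (*-identityˡ (f j))) ⟩
  ∑[ j < k ] f j ∎
  where open ≡-Reasoning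

∑-δ̄ : ∀ {k} (i : Fin k) → ∑[ j < k ] δ̄ i j ≡ k ∸ 1
∑-δ̄ {k} i = begin
  ∑[ j < k ] δ̄ i j
    ≡⟨ sum-cong-≗ (λ j → sym (*-identityʳ (δ̄ i j))) ⟩
  ∑[ j < k ] (δ̄ i j * 1)
    ≡⟨ sym (m+n∸n≡m _ 1) ⟩
  ∑[ j < k ] (δ̄ i j * 1) + 1 ∸ 1
    ≡⟨ cong (_∸ 1) (∑-without (λ _ → 1) i) ⟩
  ∑[ j < k ] 1 ∸ 1
    ≡⟨ cong (_∸ 1) (trans (∑-const k 1) (*-identityʳ k)) ⟩
  k ∸ 1 ∎
  where open ≡-Reasoning

distinct-pairs : ∀ k → ∑[ i < k ] ∑[ j < k ] δ̄ i j ≡ k * (k ∸ 1)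
distinct-pairs k = trans (sum-cong-≗ {k} (∑-δ̄ {k})) (∑-const k (k ∸ 1))

∣∣-as-∑ : ∀ {k} (p : Subset k) → ∣ p ∣ ≡ ∑[ e < k ] 𝟙 (lookup p e)
∣∣-as-∑ []          = refl
∣∣-as-∑ (true ∷ p)  = cong suc (∣∣-as-∑ p)
∣∣-as-∑ (false ∷ p) = ∣∣-as-∑ p

∣∩∣-as-∑ : ∀ {k} (p q : Subset k) →
           ∣ p ∩ q ∣ ≡ ∑[ e < k ] (𝟙 (lookup p e) * 𝟙 (lookup q e))
∣∩∣-as-∑ p q = trans (∣∣-as-∑ (p ∩ q)) (sum-cong-≗ λ e →
  trans (cong 𝟙 (lookup-zipWith _∧_ e p q)) (𝟙-∧ (lookup p e) (lookup q e)))

module _ {n : ℕ} (G : Graph n) where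

  inc : Fin n → Fin (m G) → ℕ
  inc v e = 𝟙 (incidentB G v e)

  ∑at : Fin n → (Fin (m G) → ℕ) → ℕ
  ∑at v f = ∑[ e < m G ] (f e * inc v e)

  -- Since G has no loops, v is an end of e iff it is exactly one of the two ends.
  inc-ends : ∀ v e → inc v e ≡ δ v (proj₁ (ends G e)) + δ v (proj₂ (ends G e))
  inc-ends v e with v ≟ proj₁ (ends G e) | v ≟ proj₂ (ends G e)
  ... | yes p | yes q = ⊥-elim (loopless G e (trans (sym p) q))
  ... | yes _ | no _  = refl
  ... | no _  | yes _ = refl
  ... | no _  | no _  = refl

  ends-count : ∀ e → ∑[ v < n ] inc v e ≡ 2
  ends-count e = trans (sum-cong-≗ (λ v → inc-ends v e))
    (trans (∑-distrib-+ (λ v → δ v (proj₁ (ends G e))) (λ v → δ v (proj₂ (ends G e))))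
           (cong₂ _+_ (∑-δ (proj₁ (ends G e))) (∑-δ (proj₂ (ends G e)))))

  handshake : ∀ f → ∑[ v < n ] ∑at v f ≡ 2 * ∑[ e < m G ] f e
  handshake f = begin
    ∑[ v < n ] ∑[ e < m G ] (f e * inc v e)
      ≡⟨ ∑-comm (λ v e → f e * inc v e) ⟩
    ∑[ e < m G ] ∑[ v < n ] (f e * inc v e)
      ≡⟨ sum-cong-≗ (λ e → sym (*-distribˡ-sum (f e) (λ v → inc v e))) ⟩
    ∑[ e < m G ] (f e * ∑[ v < n ] inc v e)
      ≡⟨ sum-cong-≗ (λ e → trans (cong (f e *_) (ends-count e)) (*-comm (f e) 2)) ⟩
    ∑[ e < m G ] (2 * f e)
      ≡⟨ sym (*-distribˡ-sum 2 f) ⟩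
    2 * ∑[ e < m G ] f e ∎
    where open ≡-Reasoning

  ∣∩incident∣ : ∀ M v → ∣ M ∩ incident G v ∣ ≡ ∑at v (𝟙 ∘ lookup M)
  ∣∩incident∣ M v = trans (∣∩∣-as-∑ M (incident G v)) (sum-cong-≗ λ e →
    cong (λ x → 𝟙 (lookup M e) * 𝟙 x) (lookup∘tabulate (incidentB G v) e))

  matching-at : ∀ M → PerfectMatching G M → ∀ v → ∑at v (𝟙 ∘ lookup M) ≡ 1
  matching-at M pm v = trans (sym (∣∩incident∣ M v)) (pm v)

  degree-at : Cubic G → ∀ v → ∑at v (λ _ → 1) ≡ 3
  degree-at cubic v = begin
    ∑[ e < m G ] (1 * inc v e)
      ≡⟨ sum-cong-≗ (λ e → trans (*-identityˡ (inc v e))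
                                 (cong 𝟙 (sym (lookup∘tabulate (incidentB G v) e)))) ⟩
    ∑[ e < m G ] 𝟙 (lookup (incident G v) e)
      ≡⟨ sym (∣∣-as-∑ (incident G v)) ⟩
    ∣ incident G v ∣
      ≡⟨ cubic v ⟩
    3 ∎
    where open ≡-Reasoning

module Overlaps {E k : ℕ} (Ms : Vec (Subset E) k) where

  χ : Fin k → Fin E → ℕ
  χ i e = 𝟙 (lookup (lookup Ms i) e)

  mult : Fin E → ℕ
  mult e = ∑[ i < k ] χ i e

  pairs : Fin E → ℕ
  pairs e = ∑[ i < k ] ∑[ j < k ] (δ̄ i j * (χ i e * χ j e))

  -- pairs(e) = mult(e)·(mult(e) − 1): the pairs (i, i) account for mult(e).
  pairs+mult : ∀ e → pairs e + mult e ≡ mult e * mult e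
  pairs+mult e = begin
    pairs e + ∑[ i < k ] χ i e
      ≡⟨ cong (pairs e +_) (sum-cong-≗ λ i → sym (𝟙-idem (lookup (lookup Ms i) e))) ⟩
    pairs e + ∑[ i < k ] (χ i e * χ i e)
      ≡⟨ sym (∑-distrib-+ (λ i → ∑[ j < k ] (δ̄ i j * (χ i e * χ j e))) (λ i → χ i e * χ i e)) ⟩
    ∑[ i < k ] (∑[ j < k ] (δ̄ i j * (χ i e * χ j e)) + χ i e * χ i e)
      ≡⟨ sum-cong-≗ (λ i → ∑-without (λ j → χ i e * χ j e) i) ⟩
    ∑[ i < k ] ∑[ j < k ] (χ i e * χ j e)
      ≡⟨ sum-cong-≗ (λ i → sym (*-distribˡ-sum (χ i e) (λ j → χ j e))) ⟩
    ∑[ i < k ] (χ i e * mult e)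
      ≡⟨ sym (*-distribʳ-sum (mult e) (λ i → χ i e)) ⟩
    mult e * mult e ∎
    where open ≡-Reasoning

  pairs-total : ∑[ e < E ] pairs e ≡
                ∑[ i < k ] ∑[ j < k ] (δ̄ i j * ∣ lookup Ms i ∩ lookup Ms j ∣)
  pairs-total = begin
    ∑[ e < E ] ∑[ i < k ] ∑[ j < k ] (δ̄ i j * (χ i e * χ j e))
      ≡⟨ ∑-comm (λ e i → ∑[ j < k ] (δ̄ i j * (χ i e * χ j e))) ⟩
    ∑[ i < k ] ∑[ e < E ] ∑[ j < k ] (δ̄ i j * (χ i e * χ j e))
      ≡⟨ sum-cong-≗ (λ i → ∑-comm (λ e j → δ̄ i j * (χ i e * χ j e))) ⟩
    ∑[ i < k ] ∑[ j < k ] ∑[ e < E ] (δ̄ i j * (χ i e * χ j e))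
      ≡⟨ sum-cong-≗ (λ i → sum-cong-≗ λ j → sym (*-distribˡ-sum (δ̄ i j) (λ e → χ i e * χ j e))) ⟩
    ∑[ i < k ] ∑[ j < k ] (δ̄ i j * ∑[ e < E ] (χ i e * χ j e))
      ≡⟨ sum-cong-≗ (λ i → sum-cong-≗ λ j →
           cong (δ̄ i j *_) (sym (∣∩∣-as-∑ (lookup Ms i) (lookup Ms j)))) ⟩
    ∑[ i < k ] ∑[ j < k ] (δ̄ i j * ∣ lookup Ms i ∩ lookup Ms j ∣) ∎
    where open ≡-Reasoning

  pairs-lower-bound : ∀ b → (∀ i j → b ≤ ∣ lookup Ms i ∩ lookup Ms j ∣) →
                      k * (k ∸ 1) * b ≤ ∑[ e < E ] pairs e
  pairs-lower-bound b b≤∣∩∣ = begin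
    k * (k ∸ 1) * b
      ≡⟨ cong (_* b) (sym (distinct-pairs k)) ⟩
    (∑[ i < k ] ∑[ j < k ] δ̄ i j) * b
      ≡⟨ *-distribʳ-sum b (λ i → ∑[ j < k ] δ̄ i j) ⟩
    ∑[ i < k ] ((∑[ j < k ] δ̄ i j) * b)
      ≡⟨ sum-cong-≗ {k} (λ i → *-distribʳ-sum b (δ̄ i)) ⟩
    ∑[ i < k ] ∑[ j < k ] (δ̄ i j * b)
      ≤⟨ ∑-mono-≤ (λ i → ∑-mono-≤ λ j → *-monoʳ-≤ (δ̄ i j) (b≤∣∩∣ i j)) ⟩
    ∑[ i < k ] ∑[ j < k ] (δ̄ i j * ∣ lookup Ms i ∩ lookup Ms j ∣)
      ≡⟨ sym pairs-total ⟩
    ∑[ e < E ] pairs e ∎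
    where open ≤-Reasoning

-- The estimate behind the local bound at a vertex: if x·c ≤ s for an
-- indicator c, then (x+1)·x·c ≤ (s+1)·(x·c).
weighted-bound : ∀ x s c → x * 𝟙 c ≤ s → suc x * x * 𝟙 c ≤ suc s * (x * 𝟙 c)
weighted-bound x s false _
  rewrite *-zeroʳ (suc x * x) | *-zeroʳ x | *-zeroʳ (suc s) = z≤n
weighted-bound x s true x≤s
  rewrite *-identityʳ (suc x * x) | *-identityʳ x = *-monoˡ-≤ x (s≤s x≤s)

module MatchingCover {n : ℕ} (G : Graph n) (cubic : Cubic G)
  {k : ℕ} (Ms : Vec (Subset (m G)) k)
  (perfect : ∀ i → PerfectMatching G (lookup Ms i))
  (covers : ∀ e → ∃ λ i → e ∈ lookup Ms i) where

  open Overlaps Ms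

  -- Every matching meets the edges at v once, so their multiplicities sum to k.
  mult-at : ∀ v → ∑at G v mult ≡ k
  mult-at v = begin
    ∑[ e < m G ] ((∑[ i < k ] χ i e) * inc G v e)
      ≡⟨ sum-cong-≗ (λ e → *-distribʳ-sum (inc G v e) (λ i → χ i e)) ⟩
    ∑[ e < m G ] ∑[ i < k ] (χ i e * inc G v e)
      ≡⟨ ∑-comm (λ e i → χ i e * inc G v e) ⟩
    ∑[ i < k ] ∑at G v (χ i)
      ≡⟨ sum-cong-≗ (λ i → matching-at G (lookup Ms i) (perfect i) v) ⟩
    ∑[ i < k ] 1
      ≡⟨ trans (∑-const k 1) (*-identityʳ k) ⟩
    k ∎
    where open ≡-Reasoning

  mult-pos : ∀ e → 1 ≤ mult e
  mult-pos e with covers e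
  ... | i , e∈Mᵢ = subst (λ x → 𝟙 x ≤ mult e) ([]=⇒lookup e∈Mᵢ) (∑-term-≤ (λ i → χ i e) i)

  excess : Fin (m G) → ℕ
  excess e = mult e ∸ 1

  -- Since mult(e) ≥ 1, it is 1 + excess(e) on the nose.
  mult≡1+excess : ∀ e → mult e ≡ suc (excess e)
  mult≡1+excess e = sym (m+[n∸m]≡n (mult-pos e))

  pairs≡ : ∀ e → pairs e ≡ suc (excess e) * excess e
  pairs≡ e = +-cancelʳ-≡ (suc x) (pairs e) (suc x * x) (begin
    pairs e + suc x    ≡⟨ cong (pairs e +_) (sym (mult≡1+excess e)) ⟩
    pairs e + mult e   ≡⟨ pairs+mult e ⟩
    mult e * mult e    ≡⟨ cong (λ y → y * y) (mult≡1+excess e) ⟩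
    suc x * suc x      ≡⟨ square x ⟩
    suc x * x + suc x  ∎)
    where
    x = excess e
    open ≡-Reasoning
    square : ∀ x → suc x * suc x ≡ suc x * x + suc x
    square = solve-∀

  excess-at : ∀ v → 3 + ∑at G v excess ≡ k
  excess-at v = begin
    3 + ∑at G v excess
      ≡⟨ cong (_+ ∑at G v excess) (sym (degree-at G cubic v)) ⟩
    ∑at G v (λ _ → 1) + ∑at G v excess
      ≡⟨ sym (∑-distrib-+ (λ e → 1 * inc G v e) (λ e → excess e * inc G v e)) ⟩
    ∑[ e < m G ] (1 * inc G v e + excess e * inc G v e)
      ≡⟨ sum-cong-≗ (λ e → sym (*-distribʳ-+ (inc G v e) 1 (excess e))) ⟩
    ∑at G v (λ e → suc (excess e))
      ≡⟨ sum-cong-≗ (λ e → cong (_* inc G v e) (sym (mult≡1+excess e))) ⟩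
    ∑at G v mult
      ≡⟨ mult-at v ⟩
    k ∎
    where open ≡-Reasoning

  pairs-at : ∀ v → ∑at G v pairs ≤ (k ∸ 2) * (k ∸ 3)
  pairs-at v = subst (λ k′ → ∑at G v pairs ≤ (k′ ∸ 2) * (k′ ∸ 3)) (excess-at v) (begin
    ∑[ e < m G ] (pairs e * inc G v e)
      ≤⟨ ∑-mono-≤ (λ e → subst (λ y → y * inc G v e ≤ suc s * (excess e * inc G v e))
                                (sym (pairs≡ e))
                                (weighted-bound (excess e) s (incidentB G v e)
                                  (∑-term-≤ (λ e → excess e * inc G v e) e))) ⟩
    ∑[ e < m G ] (suc s * (excess e * inc G v e))
      ≡⟨ sym (*-distribˡ-sum (suc s) (λ e → excess e * inc G v e)) ⟩
    suc s * s ∎)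
    where
    s = ∑at G v excess
    open ≤-Reasoning

  pairs-upper-bound : 2 * ∑[ e < m G ] pairs e ≤ n * ((k ∸ 2) * (k ∸ 3))
  pairs-upper-bound = begin
    2 * ∑[ e < m G ] pairs e
      ≡⟨ sym (handshake G pairs) ⟩
    ∑[ v < n ] ∑at G v pairs
      ≤⟨ ∑-mono-≤ pairs-at ⟩
    ∑[ v < n ] ((k ∸ 2) * (k ∸ 3))
      ≡⟨ ∑-const n ((k ∸ 2) * (k ∸ 3)) ⟩
    n * ((k ∸ 2) * (k ∸ 3)) ∎
    where open ≤-Reasoning

  -- Every Mᵢ ∩ Mⱼ is balanced, so a lower bound b on balanced matchings gives
  -- 2k(k − 1)·b ≤ (k − 2)(k − 3)·n.
  cover-bound : ∀ b → (∀ A → Balanced G A → b ≤ ∣ A ∣) →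
                2 * (k * (k ∸ 1) * b) ≤ n * ((k ∸ 2) * (k ∸ 3))
  cover-bound b b≤balanced = ≤-trans
    (*-monoʳ-≤ 2 (pairs-lower-bound b λ i j →
      b≤balanced _ (lookup Ms i , lookup Ms j , perfect i , perfect j , refl)))
    pairs-upper-bound

-- For k = 4 the general bound reads 24·b ≤ 2·n.
proposition3p6 : (n : ℕ) (G : Graph n) → Cubic G → Bridgeless G → IsTau G 4 →
    (b : ℕ) → IsB G b → 12 * b ≤ n
proposition3p6 n G cubic _ ((Ms , perfect , covers) , _) b (_ , b≤balanced) =
  *-cancelˡ-≤ 2 (begin
    2 * (12 * b)  ≤⟨ cover-bound b b≤balanced ⟩
    n * 2         ≡⟨ *-comm n 2 ⟩
    2 * n         ∎)
  where
  open MatchingCover G cubic Ms perfect covers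
  open ≤-Reasoning
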